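{- Let $\mathcal L$ be a summable category with summability structure $(S,\pi_0,\pi_1,\sigma)$. Then $(S,\iota_0,\mu)$ is a monad on $\mathcal L$, and $\mu_X\circ c_X=\mu_X$ for every object $X$.
   Context: Let $\mathcal L$ be a category enriched over pointed sets (each hom-set has a distinguished $0$ with $g\circ 0=0$, $0\circ f=0$). A pre-summability structure is $(S,\pi_0,\pi_1,\sigma)$ with $S:\mathcal L\to\mathcal L$ a functor, $S0=0$, and $\pi_0,\pi_1,\sigma$ natural transformations $S\Rightarrow\mathrm{Id}$ with $\pi_0,\pi_1$ jointly monic. $f_0,f_1\in\mathcal L(X,Y)$ are summable if there is (necessarily unique) $\langle f_0,f_1\rangle_S\in\mathcal L(X,SY)$ with $\pi_i\circ\langle f_0,f_1\rangle_S=f_i$; then $f_0+f_1:=\sigma\circ\langle f_0,f_1\rangle_S$. A summable category is one equipped with such a structure satisfying: (S-com) $\pi_1,\pi_0$ are summable and $\sigma\circ\langle\pi_1,\pi_0\rangle_S=\sigma$; (S-zero) for each $f$, $f$ and $0$ are summable with $f+0=f$; (S-witness) if $(f_{00},f_{01})$, $(f_{10},f_{11})$ are summable and $(f_{00}+f_{01},f_{10}+f_{11})$ is summable then $\langle f_{00},f_{01}\rangle_S,\langle f_{10},f_{11}\rangle_S$ are summable; (S-assoc) $S(\sigma_X)\circ c_X=\sigma_{SX}$, where $c_X\in\mathcal L(S^2X,S^2X)$ is the unique morphism with $\pi_{i,X}\circ\pi_{j,SX}\circ c_X=\pi_{j,X}\circ\pi_{i,SX}$ for all $i,j\in\{0,1\}$.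 Define $\iota_{0,X}=\langle\mathrm{id}_X,0\rangle_S\in\mathcal L(X,SX)$, and $\mu_X\in\mathcal L(S^2X,SX)$ as the witness $\langle\pi_{0,X}\circ\pi_{0,SX},\ \pi_{1,X}\circ\pi_{0,SX}+\pi_{0,X}\circ\pi_{1,SX}\rangle_S$ (these two morphisms are summable in any summable category). -}

module Defs where

open import Level using (Level; _⊔_) renaming (suc to lsuc)
open import Data.Product using (Σ; Σ-syntax; _×_; _,_; proj₁; proj₂)
open import Data.Bool using (Bool; false; true)
open import Relation.Binary.PropositionalEquality using (_≡_)

-- A category enriched over pointed sets: hom-sets with a distinguished
-- zero morphism absorbed by composition on both sides.
record PCat (o h : Level) : Set (lsuc (o ⊔ h)) where
  infixr 9 _∘_
  field
    Obj   : Set o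
    Hom   : Obj → Obj → Set h
    id    : ∀ {X} → Hom X X
    _∘_   : ∀ {X Y Z} → Hom Y Z → Hom X Y → Hom X Z
    idˡ   : ∀ {X Y} (f : Hom X Y) → id ∘ f ≡ f
    idʳ   : ∀ {X Y} (f : Hom X Y) → f ∘ id ≡ f
    assoc : ∀ {W X Y Z} (h : Hom Y Z) (g : Hom X Y) (f : Hom W X) →
            (h ∘ g) ∘ f ≡ h ∘ (g ∘ f)
    0m    : ∀ {X Y} → Hom X Y
    zeroʳ : ∀ {X Y Z} (g : Hom Y Z) → g ∘ 0m {X} {Y} ≡ 0m
    zeroˡ : ∀ {X Y Z} (f : Hom X Y) → 0m {Y} {Z} ∘ f ≡ 0m

record PreSummability {o h} (L : PCat o h) : Set (o ⊔ h) where
  open PCat L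
  field
    S₀     : Obj → Obj
    S₁     : ∀ {X Y} → Hom X Y → Hom (S₀ X) (S₀ Y)
    S-id   : ∀ {X} → S₁ (id {X}) ≡ id
    S-∘    : ∀ {X Y Z} (g : Hom Y Z) (f : Hom X Y) → S₁ (g ∘ f) ≡ S₁ g ∘ S₁ f
    S-0    : ∀ {X Y} → S₁ (0m {X} {Y}) ≡ 0m
    π      : Bool → ∀ X → Hom (S₀ X) X
    σ      : ∀ X → Hom (S₀ X) X
    π-nat  : ∀ b {X Y} (f : Hom X Y) → π b Y ∘ S₁ f ≡ f ∘ π b X
    σ-nat  : ∀ {X Y} (f : Hom X Y) → σ Y ∘ S₁ f ≡ f ∘ σ X
    π-mono : ∀ {X Y} (f g : Hom X (S₀ Y)) →
             π false Y ∘ f ≡ π false Y ∘ g → π true Y ∘ f ≡ π true Y ∘ g → f ≡ g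

  π₀ π₁ : ∀ X → Hom (S₀ X) X
  π₀ = π false
  π₁ = π true

  Summable : ∀ {X Y} → Hom X Y → Hom X Y → Set h
  Summable {X} {Y} f₀ f₁ = Σ[ w ∈ Hom X (S₀ Y) ] (π₀ Y ∘ w ≡ f₀ × π₁ Y ∘ w ≡ f₁)

  ⟨_⟩S : ∀ {X Y} {f₀ f₁ : Hom X Y} → Summable f₀ f₁ → Hom X (S₀ Y)
  ⟨ p ⟩S = proj₁ p

  sum : ∀ {X Y} {f₀ f₁ : Hom X Y} → Summable f₀ f₁ → Hom X Y
  sum {Y = Y} p = σ Y ∘ proj₁ p

  IsC : ∀ X → Hom (S₀ (S₀ X)) (S₀ (S₀ X)) → Set h
  IsC X c = ∀ i j → π i X ∘ (π j (S₀ X) ∘ c) ≡ π j X ∘ π i (S₀ X)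

record SummableCat (o h : Level) : Set (lsuc (o ⊔ h)) where
  field
    L   : PCat o h
    pre : PreSummability L
  open PCat L public
  open PreSummability pre public
  field
    S-com     : ∀ X → Σ[ p ∈ Summable (π₁ X) (π₀ X) ] (sum p ≡ σ X)
    S-zero    : ∀ {X Y} (f : Hom X Y) → Σ[ p ∈ Summable f 0m ] (sum p ≡ f)
    S-witness : ∀ {X Y} {f₀₀ f₀₁ f₁₀ f₁₁ : Hom X Y}
                (p : Summable f₀₀ f₀₁) (q : Summable f₁₀ f₁₁) →
                Summable (sum p) (sum q) → Summable ⟨ p ⟩S ⟨ q ⟩S
    S-assoc   : ∀ X → Σ[ c ∈ Hom (S₀ (S₀ X)) (S₀ (S₀ X)) ]
                  (IsC X c × S₁ (σ X) ∘ c ≡ σ (S₀ X))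

  ι₀ : ∀ X → Hom X (S₀ X)
  ι₀ X = ⟨ proj₁ (S-zero (id {X})) ⟩S

record IsMonad {o h} (C : SummableCat o h) (η : ∀ X → SummableCat.Hom C X (SummableCat.S₀ C X))
               (μ : ∀ X → SummableCat.Hom C (SummableCat.S₀ C (SummableCat.S₀ C X)) (SummableCat.S₀ C X))
               : Set (o ⊔ h) where
  open SummableCat C
  field
    η-nat  : ∀ {X Y} (f : Hom X Y) → S₁ f ∘ η X ≡ η Y ∘ f
    μ-nat  : ∀ {X Y} (f : Hom X Y) → S₁ f ∘ μ X ≡ μ Y ∘ S₁ (S₁ f)
    μ-assoc : ∀ X → μ X ∘ S₁ (μ X) ≡ μ X ∘ μ (S₀ X)
    μ-idˡ  : ∀ X → μ X ∘ η (S₀ X) ≡ id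
    μ-idʳ  : ∀ X → μ X ∘ S₁ (η X) ≡ id

{-# OPTIONS --safe #-}
-- Everything follows from uniqueness of witnesses: two morphisms into S Y
-- agree as soon as their two projections do. The one substantial fact is
-- associativity of partial sums: if a + b and (a + b) + c are defined, so are
-- b + c and a + (b + c), with the same value. To see it, apply S-witness to
-- ⟨b , a⟩ and ⟨c , 0⟩ to get a 2×2 matrix; its transpose has rows ⟨b , c⟩ and
-- ⟨a , 0⟩, and S-assoc says that summing a matrix by rows or by columns
-- gives the same result. Regrouping the entries of S²X this way produces μ,
-- and each monad law reduces to associativity, commutativity or the zero law.
module Submission where

open import Defs
open import Level using (Level)
open import Data.Bool using (Bool; false; true)
open import Data.Product using (Σ-syntax; _×_; _,_; proj₁; proj₂)
open import Relation.Binary.PropositionalEquality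
  using (_≡_; refl; sym; trans; cong; subst; module ≡-Reasoning)

module SummableCatProperties {o h : Level} (C : SummableCat o h) where
  open SummableCat C
  open ≡-Reasoning

  private variable
    U V X Y Z : Obj

  pullˡ : ∀ {a : Hom Y Z} {b : Hom X Y} {c : Hom X Z} (f : Hom V X) →
          a ∘ b ≡ c → a ∘ (b ∘ f) ≡ c ∘ f
  pullˡ {a = a} {b} f ab≡c = trans (sym (assoc a b f)) (cong (_∘ f) ab≡c)

  extendʳ : ∀ {a : Hom Y Z} {b : Hom X Y} {c : Hom U Z} {d : Hom X U} (f : Hom V X) →
            a ∘ b ≡ c ∘ d → a ∘ (b ∘ f) ≡ c ∘ (d ∘ f)
  extendʳ {c = c} {d} f ab≡cd = trans (pullˡ f ab≡cd) (assoc c d f)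

  Witness : Hom X (S₀ Y) → Hom X Y → Hom X Y → Set h
  Witness {Y = Y} w f g = π₀ Y ∘ w ≡ f × π₁ Y ∘ w ≡ g

  witness-cong : ∀ {w : Hom X (S₀ Y)} {f g f′ g′} →
                 Witness w f g → f ≡ f′ → g ≡ g′ → Witness w f′ g′
  witness-cong (p , q) f≡f′ g≡g′ = trans p f≡f′ , trans q g≡g′

  witness-unique : ∀ {w w′ : Hom X (S₀ Y)} {f g} → Witness w f g → Witness w′ f g → w ≡ w′
  witness-unique (p , q) (p′ , q′) = π-mono _ _ (trans p (sym p′)) (trans q (sym q′))

  sum-unique : ∀ {w w′ : Hom X (S₀ Y)} {f g} →
               Witness w f g → Witness w′ f g → σ Y ∘ w ≡ σ Y ∘ w′
  sum-unique {Y = Y} p q = cong (σ Y ∘_) (witness-unique p q)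

  witness-id : Witness (id {S₀ Y}) (π₀ Y) (π₁ Y)
  witness-id = idʳ _ , idʳ _

  witness-∘ : ∀ {w : Hom X (S₀ Y)} {f g} (k : Hom V X) →
              Witness w f g → Witness (w ∘ k) (f ∘ k) (g ∘ k)
  witness-∘ k (p , q) = pullˡ k p , pullˡ k q

  witness-S₁ : ∀ {w : Hom X (S₀ Y)} {f g} (k : Hom Y Z) →
               Witness w f g → Witness (S₁ k ∘ w) (k ∘ f) (k ∘ g)
  witness-S₁ {w = w} k (p , q) =
    trans (extendʳ w (π-nat false k)) (cong (k ∘_) p) ,
    trans (extendʳ w (π-nat true k)) (cong (k ∘_) q)

  σ-S₁ : (k : Hom Y Z) (w : Hom X (S₀ Y)) → σ Z ∘ (S₁ k ∘ w) ≡ k ∘ (σ Y ∘ w)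
  σ-S₁ k w = extendʳ w (σ-nat k)

  swap : ∀ X → Hom (S₀ X) (S₀ X)
  swap X = ⟨ proj₁ (S-com X) ⟩S

  witness-swap : ∀ {w : Hom X (S₀ Y)} {f g} → Witness w f g → Witness (swap Y ∘ w) g f
  witness-swap {Y = Y} {w} (p , q) =
    trans (pullˡ w (proj₁ (proj₂ (proj₁ (S-com Y))))) q ,
    trans (pullˡ w (proj₂ (proj₂ (proj₁ (S-com Y))))) p

  σ-swap : (w : Hom X (S₀ Y)) → σ Y ∘ (swap Y ∘ w) ≡ σ Y ∘ w
  σ-swap {Y = Y} w = pullˡ w (proj₂ (S-com Y))

  zero-witness : (f : Hom X Y) → Witness ⟨ proj₁ (S-zero f) ⟩S f 0m
  zero-witness f = proj₂ (proj₁ (S-zero f))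

  ι₀-witness : ∀ X → Witness (ι₀ X) id 0m
  ι₀-witness X = zero-witness id

  sum-identityʳ : ∀ {w : Hom X (S₀ Y)} {f} → Witness w f 0m → σ Y ∘ w ≡ f
  sum-identityʳ {f = f} p = trans (sum-unique p (zero-witness f)) (proj₂ (S-zero f))

  sum-identityˡ : ∀ {w : Hom X (S₀ Y)} {f} → Witness w 0m f → σ Y ∘ w ≡ f
  sum-identityˡ {w = w} p = trans (sym (σ-swap w)) (sum-identityʳ (witness-swap p))

  Entries : Hom X (S₀ (S₀ Y)) → (a b c d : Hom X Y) → Set h
  Entries {Y = Y} M a b c d = Witness (π₀ (S₀ Y) ∘ M) a b × Witness (π₁ (S₀ Y) ∘ M) c d

  transpose : ∀ X → Hom (S₀ (S₀ X)) (S₀ (S₀ X))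
  transpose X = proj₁ (S-assoc X)

  IsC-∘ : ∀ {c} → IsC X c → ∀ i j (M : Hom V (S₀ (S₀ X))) →
          π i X ∘ (π j (S₀ X) ∘ (c ∘ M)) ≡ π j X ∘ (π i (S₀ X) ∘ M)
  IsC-∘ {X = X} {c = c} isC i j M = begin
    π i X ∘ (π j (S₀ X) ∘ (c ∘ M))  ≡⟨ cong (π i X ∘_) (sym (assoc _ c M)) ⟩
    π i X ∘ ((π j (S₀ X) ∘ c) ∘ M)  ≡⟨ pullˡ M (isC i j) ⟩
    (π j X ∘ π i (S₀ X)) ∘ M        ≡⟨ assoc _ _ M ⟩
    π j X ∘ (π i (S₀ X) ∘ M)        ∎

  entries-transpose : ∀ {M : Hom X (S₀ (S₀ Y))} {a b c d} →
                      Entries M a b c d → Entries (transpose Y ∘ M) a c b d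
  entries-transpose {Y = Y} {M} ((a , b) , (c , d)) =
    (trans (entry false false) a , trans (entry true false) c) ,
    (trans (entry false true) b , trans (entry true true) d)
    where entry = λ i j → IsC-∘ (proj₁ (proj₂ (S-assoc Y))) i j M

  double-sum-transpose : (M : Hom X (S₀ (S₀ Y))) →
                         σ Y ∘ (S₁ (σ Y) ∘ (transpose Y ∘ M)) ≡ σ Y ∘ (S₁ (σ Y) ∘ M)
  double-sum-transpose {Y = Y} M = begin
    σ Y ∘ (S₁ (σ Y) ∘ (transpose Y ∘ M))
      ≡⟨ cong (σ Y ∘_) (pullˡ M (proj₂ (proj₂ (S-assoc Y)))) ⟩
    σ Y ∘ (σ (S₀ Y) ∘ M)                  ≡⟨ extendʳ M (sym (σ-nat (σ Y))) ⟩
    σ Y ∘ (S₁ (σ Y) ∘ M)                  ∎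

  row-sums-witness : (M : Hom X (S₀ (S₀ Y))) →
                     Witness (S₁ (σ Y) ∘ M) (σ Y ∘ (π₀ (S₀ Y) ∘ M))
                                            (σ Y ∘ (π₁ (S₀ Y) ∘ M))
  row-sums-witness {Y = Y} M = witness-S₁ (σ Y) (refl , refl)

  record Reassociation {X Y : Obj} (a b c : Hom X Y) (W : Hom X (S₀ Y)) : Set h where
    field
      inner         : Hom X (S₀ Y)
      inner-witness : Witness inner b c
      outer         : Hom X (S₀ Y)
      outer-witness : Witness outer a (σ Y ∘ inner)
      outer-sum     : σ Y ∘ outer ≡ σ Y ∘ W

  reassociate : ∀ {a b c : Hom X Y} {A W} → Witness A a b → Witness W (σ Y ∘ A) c →
                Reassociation a b c W
  reassociate {Y = Y} {a} {b} {c} {A} {W} A⊩ab W⊩ = record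
    { inner         = π₀ (S₀ Y) ∘ T
    ; inner-witness = proj₁ T-entries
    ; outer         = swap Y ∘ (S₁ (σ Y) ∘ T)
    ; outer-witness = witness-swap (witness-cong (row-sums-witness T) refl
                                                 (sum-identityʳ (proj₂ T-entries)))
    ; outer-sum     = begin
        σ Y ∘ (swap Y ∘ (S₁ (σ Y) ∘ T))  ≡⟨ σ-swap _ ⟩
        σ Y ∘ (S₁ (σ Y) ∘ T)             ≡⟨ double-sum-transpose M ⟩
        σ Y ∘ (S₁ (σ Y) ∘ M)
          ≡⟨ sum-unique (witness-cong (row-sums-witness M) row₀-sum row₁-sum) W⊩ ⟩
        σ Y ∘ W                          ∎
    }
    where
    ba : Summable b a
    ba = swap Y ∘ A , witness-swap A⊩ab
    c0 : Summable c 0m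
    c0 = proj₁ (S-zero c)
    M-witness : Summable ⟨ ba ⟩S ⟨ c0 ⟩S
    M-witness = S-witness ba c0
      (W , trans (proj₁ W⊩) (sym (σ-swap A)) , trans (proj₂ W⊩) (sym (proj₂ (S-zero c))))
    M : Hom _ (S₀ (S₀ Y))
    M = ⟨ M-witness ⟩S
    M-entries : Entries M b a c 0m
    M-entries = subst (λ w → Witness w b a) (sym (proj₁ (proj₂ M-witness))) (proj₂ ba) ,
                subst (λ w → Witness w c 0m) (sym (proj₂ (proj₂ M-witness))) (proj₂ c0)
    T : Hom _ (S₀ (S₀ Y))
    T = transpose Y ∘ M
    T-entries : Entries T b c a 0m
    T-entries = entries-transpose M-entries
    row₀-sum : σ Y ∘ (π₀ (S₀ Y) ∘ M) ≡ σ Y ∘ A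
    row₀-sum = trans (cong (σ Y ∘_) (proj₁ (proj₂ M-witness))) (σ-swap A)
    row₁-sum : σ Y ∘ (π₁ (S₀ Y) ∘ M) ≡ c
    row₁-sum = trans (cong (σ Y ∘_) (proj₂ (proj₂ M-witness))) (proj₂ (S-zero c))

  +-assoc : ∀ {a b c : Hom X Y} {A W B V} → Witness A a b → Witness W (σ Y ∘ A) c →
            Witness B b c → Witness V a (σ Y ∘ B) → σ Y ∘ V ≡ σ Y ∘ W
  +-assoc A⊩ W⊩ B⊩ V⊩ =
    trans (sum-unique (witness-cong V⊩ refl (sum-unique B⊩ inner-witness)) outer-witness)
          outer-sum
    where open Reassociation (reassociate A⊩ W⊩)

  summable-left : ∀ {a b c : Hom X Y} {B W} →
                  Witness B b c → Witness W a (σ Y ∘ B) → Summable a b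
  summable-left {Y = Y} {B = B} B⊩ W⊩ = swap Y ∘ inner , witness-swap inner-witness
    where
    open Reassociation (reassociate (witness-swap B⊩)
                                    (witness-cong (witness-swap W⊩) (sym (σ-swap B)) refl))

  entry : Bool → Bool → ∀ X → Hom (S₀ (S₀ X)) X
  entry i j X = π j X ∘ π i (S₀ X)

  row₀-sum+entry₁₀ : ∀ X → Summable (σ X ∘ π₀ (S₀ X)) (entry true false X)
  row₀-sum+entry₁₀ X =
    summable-left {B = π₁ (S₀ X)} (refl , refl) (π-nat false (σ X) , π-nat true (σ X))

  -- With xᵢⱼ = entry i j X, S₁ (σ X) witnesses (x₀₀ + x₀₁) + (x₁₀ + x₁₁);
  -- splitting off x₁₁ and regrouping gives x₀₀ + (x₀₁ + x₁₀).
  μ-reassociation : ∀ X → Reassociation (entry false false X) (entry false true X)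
                                         (entry true false X) ⟨ row₀-sum+entry₁₀ X ⟩S
  μ-reassociation X = reassociate (refl , refl) (proj₂ (row₀-sum+entry₁₀ X))

  cross : ∀ X → Hom (S₀ (S₀ X)) (S₀ X)
  cross X = Reassociation.inner (μ-reassociation X)

  cross-witness : ∀ X → Witness (cross X) (entry false true X) (entry true false X)
  cross-witness X = Reassociation.inner-witness (μ-reassociation X)

  μ : ∀ X → Hom (S₀ (S₀ X)) (S₀ X)
  μ X = Reassociation.outer (μ-reassociation X)

  μ-witness : ∀ X → Witness (μ X) (entry false false X) (σ X ∘ cross X)
  μ-witness X = Reassociation.outer-witness (μ-reassociation X)

  entry-S₁ : ∀ i {j} {k : Hom Z (S₀ X)} {g} → π j X ∘ k ≡ g → entry i j X ∘ S₁ k ≡ g ∘ π i Z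
  entry-S₁ {Z = Z} {X = X} i {j} {k} {g} πⱼk≡g = begin
    (π j X ∘ π i (S₀ X)) ∘ S₁ k  ≡⟨ assoc _ _ _ ⟩
    π j X ∘ (π i (S₀ X) ∘ S₁ k)  ≡⟨ cong (π j X ∘_) (π-nat i k) ⟩
    π j X ∘ (k ∘ π i Z)          ≡⟨ pullˡ (π i Z) πⱼk≡g ⟩
    g ∘ π i Z                    ∎

  entry-natural : ∀ i j (f : Hom X Y) → f ∘ entry i j X ≡ entry i j Y ∘ S₁ (S₁ f)
  entry-natural {X = X} {Y = Y} i j f = sym (begin
    entry i j Y ∘ S₁ (S₁ f)   ≡⟨ entry-S₁ i (π-nat j f) ⟩
    (f ∘ π j X) ∘ π i (S₀ X)  ≡⟨ assoc _ _ _ ⟩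
    f ∘ entry i j X           ∎)

  ι₀-natural : (f : Hom X Y) → S₁ f ∘ ι₀ X ≡ ι₀ Y ∘ f
  ι₀-natural f = witness-unique
    (witness-cong (witness-S₁ f (ι₀-witness _)) (trans (idʳ f) (sym (idˡ f)))
                                                (trans (zeroʳ f) (sym (zeroˡ f))))
    (witness-∘ f (ι₀-witness _))

  μ-natural : (f : Hom X Y) → S₁ f ∘ μ X ≡ μ Y ∘ S₁ (S₁ f)
  μ-natural {X = X} {Y = Y} f = witness-unique
    (witness-cong (witness-S₁ f (μ-witness X)) (entry-natural false false f) sum-natural)
    (witness-∘ (S₁ (S₁ f)) (μ-witness Y))
    where
    cross-natural : S₁ f ∘ cross X ≡ cross Y ∘ S₁ (S₁ f)
    cross-natural = witness-unique
      (witness-cong (witness-S₁ f (cross-witness X))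
                    (entry-natural false true f) (entry-natural true false f))
      (witness-∘ (S₁ (S₁ f)) (cross-witness Y))
    sum-natural : f ∘ (σ X ∘ cross X) ≡ (σ Y ∘ cross Y) ∘ S₁ (S₁ f)
    sum-natural = begin
      f ∘ (σ X ∘ cross X)            ≡⟨ sym (σ-S₁ f (cross X)) ⟩
      σ Y ∘ (S₁ f ∘ cross X)         ≡⟨ cong (σ Y ∘_) cross-natural ⟩
      σ Y ∘ (cross Y ∘ S₁ (S₁ f))    ≡⟨ sym (assoc _ _ _) ⟩
      (σ Y ∘ cross Y) ∘ S₁ (S₁ f)    ∎

  μ-ι₀ : ∀ X → μ X ∘ ι₀ (S₀ X) ≡ id
  μ-ι₀ X = witness-unique
    (witness-cong (witness-∘ (ι₀ (S₀ X)) (μ-witness X)) row₀ row₁) witness-id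
    where
    ι = ι₀-witness (S₀ X)
    row₀ : entry false false X ∘ ι₀ (S₀ X) ≡ π₀ X
    row₀ = trans (assoc _ _ _) (trans (cong (π₀ X ∘_) (proj₁ ι)) (idʳ _))
    cross-ι : Witness (cross X ∘ ι₀ (S₀ X)) (π₁ X) 0m
    cross-ι = witness-cong (witness-∘ (ι₀ (S₀ X)) (cross-witness X))
      (trans (assoc _ _ _) (trans (cong (π₁ X ∘_) (proj₁ ι)) (idʳ _)))
      (trans (assoc _ _ _) (trans (cong (π₀ X ∘_) (proj₂ ι)) (zeroʳ _)))
    row₁ : (σ X ∘ cross X) ∘ ι₀ (S₀ X) ≡ π₁ X
    row₁ = trans (assoc _ _ _) (sum-identityʳ cross-ι)

  μ-S₁ι₀ : ∀ X → μ X ∘ S₁ (ι₀ X) ≡ id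
  μ-S₁ι₀ X = witness-unique
    (witness-cong (witness-∘ (S₁ (ι₀ X)) (μ-witness X)) row₀ row₁) witness-id
    where
    ι = ι₀-witness X
    row₀ : entry false false X ∘ S₁ (ι₀ X) ≡ π₀ X
    row₀ = trans (entry-S₁ false (proj₁ ι)) (idˡ _)
    cross-ι : Witness (cross X ∘ S₁ (ι₀ X)) 0m (π₁ X)
    cross-ι = witness-cong (witness-∘ (S₁ (ι₀ X)) (cross-witness X))
      (trans (entry-S₁ false (proj₂ ι)) (zeroˡ _))
      (trans (entry-S₁ true (proj₁ ι)) (idˡ _))
    row₁ : (σ X ∘ cross X) ∘ S₁ (ι₀ X) ≡ π₁ X
    row₁ = trans (assoc _ _ _) (sum-identityˡ cross-ι)

  μ-transpose-invariant : ∀ {c} → IsC X c → μ X ∘ c ≡ μ X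
  μ-transpose-invariant {X = X} {c} isC = witness-unique
    (witness-cong (witness-∘ c (μ-witness X)) (trans (assoc _ _ _) (isC false false)) cross-sum)
    (μ-witness X)
    where
    cross-c : Witness (cross X ∘ c) (entry true false X) (entry false true X)
    cross-c = witness-cong (witness-∘ c (cross-witness X))
      (trans (assoc _ _ _) (isC true false)) (trans (assoc _ _ _) (isC false true))
    cross-sum : (σ X ∘ cross X) ∘ c ≡ σ X ∘ cross X
    cross-sum = begin
      (σ X ∘ cross X) ∘ c             ≡⟨ assoc _ _ _ ⟩
      σ X ∘ (cross X ∘ c)             ≡⟨ sym (σ-swap _) ⟩
      σ X ∘ (swap X ∘ (cross X ∘ c))  ≡⟨ sum-unique (witness-swap cross-c) (cross-witness X) ⟩
      σ X ∘ cross X                   ∎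

  μ-assoc : ∀ X → μ X ∘ S₁ (μ X) ≡ μ X ∘ μ (S₀ X)
  μ-assoc X = witness-unique
    (witness-cong (witness-∘ (S₁ (μ X)) (μ-witness X))
      (trans (entry-S₁ false (proj₁ (μ-witness X))) (assoc _ _ _))
      (assoc _ _ _))
    (witness-cong (witness-∘ (μ (S₀ X)) (μ-witness X))
      (trans (assoc _ _ _) (cong (π₀ X ∘_) (proj₁ (μ-witness (S₀ X)))))
      (trans (assoc _ _ _) (+-assoc cross-π₀ cross-S₁μ S₁π₀-cross cross-μ)))
    where
    S²X = S₀ (S₀ X)
    x : Bool → Bool → Bool → Hom (S₀ S²X) X
    x a b c = π c X ∘ entry a b (S₀ X)
    cross-π₀ : Witness (cross X ∘ π₀ S²X) (x false false true) (x false true false)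
    cross-π₀ = witness-cong (witness-∘ (π₀ S²X) (cross-witness X)) (assoc _ _ _) (assoc _ _ _)
    cross-S₁μ : Witness (cross X ∘ S₁ (μ X)) (σ X ∘ (cross X ∘ π₀ S²X)) (x true false false)
    cross-S₁μ = witness-cong (witness-∘ (S₁ (μ X)) (cross-witness X))
      (trans (entry-S₁ false (proj₂ (μ-witness X))) (assoc _ _ _))
      (trans (entry-S₁ true (proj₁ (μ-witness X))) (assoc _ _ _))
    S₁π₀-cross : Witness (S₁ (π₀ X) ∘ cross (S₀ X)) (x false true false) (x true false false)
    S₁π₀-cross = witness-S₁ (π₀ X) (cross-witness (S₀ X))
    cross-μ : Witness (cross X ∘ μ (S₀ X)) (x false false true) (σ X ∘ (S₁ (π₀ X) ∘ cross (S₀ X)))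
    cross-μ = witness-cong (witness-∘ (μ (S₀ X)) (cross-witness X))
      (trans (assoc _ _ _) (cong (π₁ X ∘_) (proj₁ (μ-witness (S₀ X)))))
      (trans (assoc _ _ _) (trans (cong (π₀ X ∘_) (proj₂ (μ-witness (S₀ X))))
                                  (sym (σ-S₁ (π₀ X) (cross (S₀ X))))))

mainTheorem4 : ∀ {o h : Level} (C : SummableCat o h) → let open SummableCat C in
    Σ[ p ∈ (∀ X → Summable (π₁ X ∘ π₀ (S₀ X)) (π₀ X ∘ π₁ (S₀ X))) ]
    Σ[ q ∈ (∀ X → Summable (π₀ X ∘ π₀ (S₀ X)) (sum (p X))) ]
      (IsMonad C ι₀ (λ X → ⟨ q X ⟩S)
       × (∀ X (c : Hom (S₀ (S₀ X)) (S₀ (S₀ X))) → IsC X c → ⟨ q X ⟩S ∘ c ≡ ⟨ q X ⟩S))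
mainTheorem4 C =
  (λ X → cross X , cross-witness X) ,
  (λ X → μ X , μ-witness X) ,
  record
    { η-nat   = ι₀-natural
    ; μ-nat   = μ-natural
    ; μ-assoc = μ-assoc
    ; μ-idˡ   = μ-ι₀
    ; μ-idʳ   = μ-S₁ι₀
    } ,
  λ X c → μ-transpose-invariant
  where open SummableCatProperties C
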